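{- If the 2-sequent $\Gamma\vdash\Delta$ is derivable in $2^i_{\mathsf{LTL}}$, then $\Gamma\models_{2_{\mathsf{LTL}}}\Delta$.
   Context: Temporal formulas are built from proposition symbols (set $At$) using $\neg,\wedge,\vee,\to$ and the unary operators $\Box,\Diamond,\bigcirc$ (always, sometime, next). Positions are pairs $\langle n,S\rangle$ with $n\in\mathbb N$ and $S$ a finite set of tokens from a countably infinite set $T$. For $s=\langle n,S\rangle$, $t=\langle m,T'\rangle$: $s\oplus t=\langle n+m,S\cup T'\rangle$; $s\oplus m$ means $s\oplus\langle m,\varnothing\rangle$; $s\oplus x$ means $s\oplus\langle 0,\{x\}\rangle$. A p-formula is $A^s$; a 2-sequent is $\Gamma\vdash\Delta$ with $\Gamma,\Delta$ finite sequences of p-formulas; $x\notin s,\Gamma,\Delta$ means the token $x$ belongs to no position in $s,\Gamma,\Delta$. The calculus $2^i_{\mathsf{LTL}}$: Axiom $A^s\vdash A^s$; unrestricted Cut; weakening, contraction, exchange; classical propositional sequent rules for $\neg,\wedge,\vee,\to$ with all active p-formulas at the same position; temporal rules: from $\Gamma,A^{s\oplus t}\vdash\Delta$ infer $\Gamma,(\Box A)^s\vdash\Delta$ ($t$ any position); from $\Gamma\vdash A^{s\oplus x},\Delta$ infer $\Gamma\vdash(\Box A)^s,\Delta$; from $\Gamma,A^{s\oplus x}\vdash\Delta$ infer $\Gamma,(\Diamond A)^s\vdash\Delta$; from $\Gamma\vdash A^{s\oplus t},\Delta$ infer $\Gamma\vdash(\Diamond A)^s,\Delta$; from $\Gamma,A^{s\oplus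 1}\vdash\Delta$ infer $\Gamma,(\bigcirc A)^s\vdash\Delta$; from $\Gamma\vdash A^{s\oplus1},\Delta$ infer $\Gamma\vdash(\bigcirc A)^s,\Delta$; with $x\notin s,\Gamma,\Delta$ in the right $\Box$ and left $\Diamond$ rules; and, for every formula $A$ and position $s$, the axiom $\vdash(A\wedge\Box(A\to\bigcirc A)\to\Box A)^s$. Semantics: for $v:\mathbb N\to 2^{At}$ and $m\in\mathbb N$, $\mathbb N_v\models_m A$ is the standard satisfaction: $p$ holds iff $p\in v(m)$, Boolean clauses as usual, $\mathbb N_v\models_m\Box B$ iff $\mathbb N_v\models_k B$ for all $k\ge m$, $\mathbb N_v\models_m\Diamond B$ iff $\mathbb N_v\models_k B$ for some $k\ge m$, $\mathbb N_v\models_m\bigcirc B$ iff $\mathbb N_v\models_{m+1}B$. For $a:T\to\mathbb N$, set $a(\langle n,S\rangle)=n+\sum_{x\in S}a(x)$, and $\mathbb N_{a,v}\models A^s$ iff $\mathbb N_v\models_{a(s)}A$. $\mathbb N_{a,v}\models\Gamma\vdash\Delta$ iff, whenever all p-formulas of $\Gamma$ hold in $\mathbb N_{a,v}$, some p-formula of $\Delta$ holds. $\Gamma\models_{2_{\mathsf{LTL}}}\Delta$ iff $\mathbb N_{a,v}\models\Gamma\vdash\Delta$ for all $a$ and $v$. -}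

module Defs where

open import Data.Nat using (ℕ; zero; suc; _+_; _∸_; _≤_; _<_)
open import Data.Nat.Properties using (<-cmp)
open import Data.Bool using (Bool; T)
open import Data.List using (List; []; _∷_; _++_; [_]; map)
open import Data.Nat.ListAction using (sum)
open import Data.List.Membership.Propositional using (_∉_)
open import Data.List.Relation.Unary.All using (All)
open import Data.List.Relation.Unary.Any using (Any)
open import Data.Product using (Σ; _×_)
open import Data.Sum using (_⊎_)
open import Data.Empty using (⊥)
open import Relation.Binary.Definitions using (tri<; tri≈; tri>)

Token : Set
Token = ℕ

-- Finite sets of tokens, in a CANONICAL representation (so that two
-- positions are equal iff they denote the same pair ⟨n,S⟩).
-- A finite set {x₀ < x₁ < … < x_k} is encoded by its "gap list"
-- [x₀ , x₁ ∸ x₀ ∸ 1 , … , x_k ∸ x_{k-1} ∸ 1].  Every List ℕ encodes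
-- exactly one finite subset of ℕ and vice versa.

FinSet : Set
FinSet = List ℕ

decode : ℕ → List ℕ → List ℕ
decode b []       = []
decode b (d ∷ ds) = (b + d) ∷ decode (suc (b + d)) ds

elems : FinSet → List Token
elems = decode 0

encode : ℕ → List ℕ → List ℕ
encode b []       = []
encode b (x ∷ xs) = (x ∸ b) ∷ encode (suc x) xs

merge : List ℕ → List ℕ → List ℕ
merge []       ys = ys
merge (x ∷ xs) ys = go ys
  where
  go : List ℕ → List ℕ
  go []       = x ∷ xs
  go (y ∷ ys) with <-cmp x y
  ... | tri< _ _ _ = x ∷ merge xs (y ∷ ys)
  ... | tri≈ _ _ _ = x ∷ merge xs ys
  ... | tri> _ _ _ = y ∷ go ys

∅ : FinSet
∅ = []

｛_｝ : Token → FinSet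
｛ x ｝ = x ∷ []

_∪_ : FinSet → FinSet → FinSet
S ∪ S′ = encode 0 (merge (elems S) (elems S′))

record Pos : Set where
  constructor ⟨_,_⟩
  field
    num : ℕ
    set : FinSet
open Pos public

infixl 6 _⊕_ _⊕ₙ_ _⊕ₜ_

_⊕_ : Pos → Pos → Pos
⟨ n , S ⟩ ⊕ ⟨ m , S′ ⟩ = ⟨ n + m , S ∪ S′ ⟩

_⊕ₙ_ : Pos → ℕ → Pos
s ⊕ₙ m = s ⊕ ⟨ m , ∅ ⟩

_⊕ₜ_ : Pos → Token → Pos
s ⊕ₜ x = s ⊕ ⟨ 0 , ｛ x ｝ ⟩

data Fm (At : Set) : Set where
  atom          : At → Fm At
  ¬′_           : Fm At → Fm At
  _∧′_ _∨′_ _⇒_ : Fm At → Fm At → Fm At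
  □ ◇ ○         : Fm At → Fm At

record PFm (At : Set) : Set where
  constructor _^_
  field
    fm  : Fm At
    pos : Pos
open PFm public

_∉ₚ_ : Token → Pos → Set
x ∉ₚ s = x ∉ elems (set s)

_∉ₗ_ : {At : Set} → Token → List (PFm At) → Set
x ∉ₗ Γ = All (λ A → x ∉ₚ pos A) Γ

-- Principal/active formulas are written at the
-- head of the lists; since exchange is a rule of the calculus this is
-- immaterial.

infix 3 _⊢_

data _⊢_ {At : Set} : List (PFm At) → List (PFm At) → Set where
  ax   : ∀ {A s} → (A ^ s) ∷ [] ⊢ (A ^ s) ∷ []
  cut  : ∀ {Γ Δ Γ′ Δ′ P} → Γ ⊢ P ∷ Δ → P ∷ Γ′ ⊢ Δ′ → Γ ++ Γ′ ⊢ Δ ++ Δ′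
  wL   : ∀ {Γ Δ P} → Γ ⊢ Δ → P ∷ Γ ⊢ Δ
  wR   : ∀ {Γ Δ P} → Γ ⊢ Δ → Γ ⊢ P ∷ Δ
  cL   : ∀ {Γ Δ P} → P ∷ P ∷ Γ ⊢ Δ → P ∷ Γ ⊢ Δ
  cR   : ∀ {Γ Δ P} → Γ ⊢ P ∷ P ∷ Δ → Γ ⊢ P ∷ Δ
  eL   : ∀ Γ₁ {Γ₂ Δ P Q} → Γ₁ ++ P ∷ Q ∷ Γ₂ ⊢ Δ → Γ₁ ++ Q ∷ P ∷ Γ₂ ⊢ Δ
  eR   : ∀ {Γ} Δ₁ {Δ₂ P Q} → Γ ⊢ Δ₁ ++ P ∷ Q ∷ Δ₂ → Γ ⊢ Δ₁ ++ Q ∷ P ∷ Δ₂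
  ¬L   : ∀ {Γ Δ A s} → Γ ⊢ (A ^ s) ∷ Δ → ((¬′ A) ^ s) ∷ Γ ⊢ Δ
  ¬R   : ∀ {Γ Δ A s} → (A ^ s) ∷ Γ ⊢ Δ → Γ ⊢ ((¬′ A) ^ s) ∷ Δ
  ∧L₁  : ∀ {Γ Δ A B s} → (A ^ s) ∷ Γ ⊢ Δ → ((A ∧′ B) ^ s) ∷ Γ ⊢ Δ
  ∧L₂  : ∀ {Γ Δ A B s} → (B ^ s) ∷ Γ ⊢ Δ → ((A ∧′ B) ^ s) ∷ Γ ⊢ Δ
  ∧R   : ∀ {Γ Δ A B s} → Γ ⊢ (A ^ s) ∷ Δ → Γ ⊢ (B ^ s) ∷ Δ → Γ ⊢ ((A ∧′ B) ^ s) ∷ Δ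
  ∨L   : ∀ {Γ Δ A B s} → (A ^ s) ∷ Γ ⊢ Δ → (B ^ s) ∷ Γ ⊢ Δ → ((A ∨′ B) ^ s) ∷ Γ ⊢ Δ
  ∨R₁  : ∀ {Γ Δ A B s} → Γ ⊢ (A ^ s) ∷ Δ → Γ ⊢ ((A ∨′ B) ^ s) ∷ Δ
  ∨R₂  : ∀ {Γ Δ A B s} → Γ ⊢ (B ^ s) ∷ Δ → Γ ⊢ ((A ∨′ B) ^ s) ∷ Δ
  ⇒L   : ∀ {Γ Δ Γ′ Δ′ A B s} → Γ ⊢ (A ^ s) ∷ Δ → (B ^ s) ∷ Γ′ ⊢ Δ′ →
         ((A ⇒ B) ^ s) ∷ Γ ++ Γ′ ⊢ Δ ++ Δ′
  ⇒R   : ∀ {Γ Δ A B s} → (A ^ s) ∷ Γ ⊢ (B ^ s) ∷ Δ → Γ ⊢ ((A ⇒ B) ^ s) ∷ Δ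
  □L   : ∀ {Γ Δ A s} t → (A ^ (s ⊕ t)) ∷ Γ ⊢ Δ → ((□ A) ^ s) ∷ Γ ⊢ Δ
  □R   : ∀ {Γ Δ A s} x → x ∉ₚ s → x ∉ₗ Γ → x ∉ₗ Δ →
         Γ ⊢ (A ^ (s ⊕ₜ x)) ∷ Δ → Γ ⊢ ((□ A) ^ s) ∷ Δ
  ◇L   : ∀ {Γ Δ A s} x → x ∉ₚ s → x ∉ₗ Γ → x ∉ₗ Δ →
         (A ^ (s ⊕ₜ x)) ∷ Γ ⊢ Δ → ((◇ A) ^ s) ∷ Γ ⊢ Δ
  ◇R   : ∀ {Γ Δ A s} t → Γ ⊢ (A ^ (s ⊕ t)) ∷ Δ → Γ ⊢ ((◇ A) ^ s) ∷ Δ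
  ○L   : ∀ {Γ Δ A s} → (A ^ (s ⊕ₙ 1)) ∷ Γ ⊢ Δ → ((○ A) ^ s) ∷ Γ ⊢ Δ
  ○R   : ∀ {Γ Δ A s} → Γ ⊢ (A ^ (s ⊕ₙ 1)) ∷ Δ → Γ ⊢ ((○ A) ^ s) ∷ Δ
  ind  : ∀ {A s} → [] ⊢ (((A ∧′ □ (A ⇒ ○ A)) ⇒ □ A) ^ s) ∷ []

Valuation : Set → Set
Valuation At = ℕ → At → Bool

_⊨[_]_ : {At : Set} → Valuation At → ℕ → Fm At → Set
v ⊨[ m ] atom p  = T (v m p)
v ⊨[ m ] (¬′ A)  = v ⊨[ m ] A → ⊥
v ⊨[ m ] (A ∧′ B) = v ⊨[ m ] A × v ⊨[ m ] B
v ⊨[ m ] (A ∨′ B) = v ⊨[ m ] A ⊎ v ⊨[ m ] B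
v ⊨[ m ] (A ⇒ B)  = v ⊨[ m ] A → v ⊨[ m ] B
v ⊨[ m ] □ A     = ∀ k → m ≤ k → v ⊨[ k ] A
v ⊨[ m ] ◇ A     = Σ ℕ (λ k → m ≤ k × v ⊨[ k ] A)
v ⊨[ m ] ○ A     = v ⊨[ suc m ] A

Assignment : Set
Assignment = Token → ℕ

evalPos : Assignment → Pos → ℕ
evalPos a ⟨ n , S ⟩ = n + sum (map a (elems S))

_,_⊨ₚ_ : {At : Set} → Assignment → Valuation At → PFm At → Set
a , v ⊨ₚ (A ^ s) = v ⊨[ evalPos a s ] A

_,_⊨ₛ_⊢_ : {At : Set} → Assignment → Valuation At →
           List (PFm At) → List (PFm At) → Set
a , v ⊨ₛ Γ ⊢ Δ = All (λ P → a , v ⊨ₚ P) Γ → Any (λ P → a , v ⊨ₚ P) Δ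

_⊨₂_ : {At : Set} → List (PFm At) → List (PFm At) → Set
Γ ⊨₂ Δ = ∀ a v → a , v ⊨ₛ Γ ⊢ Δ

module Submission where

-- The proof is the usual induction on derivations; all the work lies in
-- the arithmetic of positions.  We first show that the canonical
-- finite-set encoding satisfies elems (S ∪ S′) = merge (elems S) (elems S′),
-- from which three facts about the value a(s) of a position follow:
--   * a(s ⊕ t) ≥ a(s)                (□L and ◇R instantiate at a later time),
--   * a(s ⊕ 1) = a(s) + 1            (the ○ rules),
--   * if x is fresh for s then, re-assigning x to k ∸ a(s) for k ≥ a(s),
--     the position s ⊕ x takes the value k while every position not
--     mentioning x keeps its value   (the eigen-token rules □R and ◇L).
-- Next each rule is shown to preserve truth in a model (for □R and ◇L the
-- premise is used in the re-assigned model), and the induction axiom is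
-- valid by induction on ℕ.  Excluded middle is needed for the right rules
-- that introduce ¬, ⇒ and □, whose semantic clauses are not constructive.

open import Defs
open import Data.Nat using (ℕ; suc; _+_; _∸_; _≤_; _≤′_; ≤′-refl; ≤′-step; z≤n; _≟_)
open import Data.Nat.Properties
open import Data.Nat.ListAction using (sum)
open import Data.List using (List; []; _∷_; _++_; [_]; map)
open import Data.List.Membership.Propositional using (_∉_)
open import Data.List.Relation.Unary.All using (All; []; _∷_)
import Data.List.Relation.Unary.All as All
import Data.List.Relation.Unary.All.Properties as All
open import Data.List.Relation.Unary.Any using (Any; here; there)
import Data.List.Relation.Unary.Any.Properties as Any
open import Data.List.Relation.Binary.Permutation.Propositional using (↭-refl; ↭-swap)
open import Data.List.Relation.Binary.Permutation.Propositional.Properties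
  using (All-resp-↭; Any-resp-↭; ++⁺ˡ)
open import Data.Product using (_,_)
open import Data.Sum using (inj₁; inj₂)
open import Data.Empty using (⊥-elim)
open import Relation.Nullary using (yes; no)
open import Relation.Binary.Definitions using (tri<; tri≈; tri>)
open import Relation.Binary.PropositionalEquality
  using (_≡_; refl; sym; trans; cong; cong₂; subst; module ≡-Reasoning)
open import Level using (0ℓ)
open import Axiom.ExcludedMiddle using (ExcludedMiddle)

data Ascending : ℕ → List ℕ → Set where
  []  : ∀ {b} → Ascending b []
  _∷_ : ∀ {b x xs} → b ≤ x → Ascending (suc x) xs → Ascending b (x ∷ xs)

decode-ascending : ∀ b ds → Ascending b (decode b ds)
decode-ascending b []       = []
decode-ascending b (d ∷ ds) = m≤m+n b d ∷ decode-ascending (suc (b + d)) ds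

decode-encode : ∀ {b xs} → Ascending b xs → decode b (encode b xs) ≡ xs
decode-encode []                   = refl
decode-encode {b} {x ∷ xs} (b≤x ∷ asc) rewrite m+[n∸m]≡n b≤x =
  cong (x ∷_) (decode-encode asc)

merge-ascending : ∀ {b} xs ys → Ascending b xs → Ascending b ys →
                  Ascending b (merge xs ys)
merge-ascending []       ys _                 asc-ys = asc-ys
merge-ascending (x ∷ xs) ys (b≤x ∷ asc-xs) asc-ys = go ys b≤x asc-ys
  where
  go : ∀ {c} ys → c ≤ x → Ascending c ys → Ascending c (merge (x ∷ xs) ys)
  go []       c≤x _ = c≤x ∷ asc-xs
  go (y ∷ ys) c≤x (c≤y ∷ asc) with <-cmp x y
  ... | tri< x<y _ _    = c≤x ∷ merge-ascending xs (y ∷ ys) asc-xs (x<y ∷ asc)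
  ... | tri≈ _ refl _   = c≤x ∷ merge-ascending xs ys asc-xs asc
  ... | tri> _ _ y<x    = c≤y ∷ go ys y<x asc

elems-∪ : ∀ S S′ → elems (S ∪ S′) ≡ merge (elems S) (elems S′)
elems-∪ S S′ = decode-encode
  (merge-ascending (elems S) (elems S′) (decode-ascending 0 S) (decode-ascending 0 S′))

merge-[]ʳ : ∀ xs → merge xs [] ≡ xs
merge-[]ʳ []      = refl
merge-[]ʳ (_ ∷ _) = refl

module TokenSum (a : Assignment) where

  Σ[_] : List Token → ℕ
  Σ[ xs ] = sum (map a xs)

  Σ-merge-≥ : ∀ xs ys → Σ[ xs ] ≤ Σ[ merge xs ys ]
  Σ-merge-≥ []       ys = z≤n
  Σ-merge-≥ (x ∷ xs) ys = go ys
    where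
    go : ∀ ys → Σ[ x ∷ xs ] ≤ Σ[ merge (x ∷ xs) ys ]
    go []       = ≤-refl
    go (y ∷ ys) with <-cmp x y
    ... | tri< _ _ _ = +-monoʳ-≤ (a x) (Σ-merge-≥ xs (y ∷ ys))
    ... | tri≈ _ _ _ = +-monoʳ-≤ (a x) (Σ-merge-≥ xs ys)
    ... | tri> _ _ _ = ≤-trans (go ys) (m≤n+m _ (a y))

  Σ-merge-new : ∀ xs x → x ∉ xs → Σ[ merge xs [ x ] ] ≡ Σ[ xs ] + a x
  Σ-merge-new []       x _   = +-identityʳ (a x)
  Σ-merge-new (z ∷ zs) x x∉ with <-cmp z x
  ... | tri< _ _ _   = trans (cong (a z +_) (Σ-merge-new zs x (λ x∈ → x∉ (there x∈))))
                             (sym (+-assoc (a z) _ _))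
  ... | tri≈ _ z≡x _ = ⊥-elim (x∉ (here (sym z≡x)))
  ... | tri> _ _ _   = +-comm (a x) _

open TokenSum

_[_≔_] : Assignment → Token → ℕ → Assignment
(a [ x ≔ k ]) y with y ≟ x
... | yes _ = k
... | no _  = a y

≔-here : ∀ a x k → (a [ x ≔ k ]) x ≡ k
≔-here a x k with x ≟ x
... | yes _  = refl
... | no x≢x = ⊥-elim (x≢x refl)

Σ-≔-elsewhere : ∀ a x k xs → x ∉ xs → Σ[ a [ x ≔ k ] ] xs ≡ Σ[ a ] xs
Σ-≔-elsewhere a x k []       _  = refl
Σ-≔-elsewhere a x k (y ∷ ys) x∉ with y ≟ x
... | yes y≡x = ⊥-elim (x∉ (here (sym y≡x)))
... | no _    = cong (a y +_) (Σ-≔-elsewhere a x k ys (λ x∈ → x∉ (there x∈)))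

evalPos-⊕-≥ : ∀ a s t → evalPos a s ≤ evalPos a (s ⊕ t)
evalPos-⊕-≥ a ⟨ n , S ⟩ ⟨ m , S′ ⟩ rewrite elems-∪ S S′ =
  +-mono-≤ (m≤m+n n m) (Σ-merge-≥ a (elems S) (elems S′))

evalPos-⊕-1 : ∀ a s → evalPos a (s ⊕ₙ 1) ≡ suc (evalPos a s)
evalPos-⊕-1 a ⟨ n , S ⟩ rewrite elems-∪ S [] | merge-[]ʳ (elems S) =
  cong (_+ Σ[ a ] (elems S)) (+-comm n 1)

evalPos-≔-fresh : ∀ a s x k → x ∉ₚ s → evalPos (a [ x ≔ k ]) s ≡ evalPos a s
evalPos-≔-fresh a ⟨ n , S ⟩ x k x∉ = cong (n +_) (Σ-≔-elsewhere a x k (elems S) x∉)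

evalPos-⊕-fresh : ∀ a s x k → x ∉ₚ s → evalPos (a [ x ≔ k ]) (s ⊕ₜ x) ≡ evalPos a s + k
evalPos-⊕-fresh a ⟨ n , S ⟩ x k x∉ = begin
  n + 0 + Σ[ b ] (elems (S ∪ ｛ x ｝))    ≡⟨ cong₂ _+_ (+-identityʳ n) (cong Σ[ b ] (elems-∪ S ｛ x ｝)) ⟩
  n + Σ[ b ] (merge (elems S) [ x ])     ≡⟨ cong (n +_) (Σ-merge-new b (elems S) x x∉) ⟩
  n + (Σ[ b ] (elems S) + b x)           ≡⟨ cong₂ (λ p q → n + (p + q))
                                              (Σ-≔-elsewhere a x k (elems S) x∉) (≔-here a x k) ⟩
  n + (Σ[ a ] (elems S) + k)             ≡⟨ sym (+-assoc n _ k) ⟩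
  n + Σ[ a ] (elems S) + k               ∎
  where
  open ≡-Reasoning
  b = a [ x ≔ k ]

-- The eigen-token rules rest on this: a fresh token x can be re-assigned
-- so that s ⊕ x denotes any given time k ≥ a(s).
reach : ∀ a s x k → x ∉ₚ s → evalPos a s ≤ k →
        evalPos (a [ x ≔ k ∸ evalPos a s ]) (s ⊕ₜ x) ≡ k
reach a s x k x∉ s≤k = trans (evalPos-⊕-fresh a s x _ x∉) (m+[n∸m]≡n s≤k)

module Soundness {At : Set} (v : Valuation At) where

  Holds : Assignment → PFm At → Set
  Holds a P = a , v ⊨ₚ P

  holds-resp : ∀ {a b} P → evalPos a (pos P) ≡ evalPos b (pos P) → Holds a P → Holds b P
  holds-resp (A ^ s) eq = subst (λ m → v ⊨[ m ] A) eq

  Agree : Assignment → Assignment → List (PFm At) → Set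
  Agree a b Γ = All (λ P → evalPos a (pos P) ≡ evalPos b (pos P)) Γ

  agree-sym : ∀ {a b Γ} → Agree a b Γ → Agree b a Γ
  agree-sym = All.map sym

  agree-≔-fresh : ∀ a x k {Γ} → x ∉ₗ Γ → Agree a (a [ x ≔ k ]) Γ
  agree-≔-fresh a x k = All.map (λ {P} x∉ → sym (evalPos-≔-fresh a (pos P) x k x∉))

  All-resp-agree : ∀ {a b Γ} → Agree a b Γ → All (Holds a) Γ → All (Holds b) Γ
  All-resp-agree agree hs = All.zipWith (λ {P} (eq , h) → holds-resp P eq h) (agree , hs)

  Any-resp-agree : ∀ {a b Γ} → Agree a b Γ → Any (Holds a) Γ → Any (Holds b) Γ
  Any-resp-agree {Γ = P ∷ _} (eq ∷ _) (here h) = here (holds-resp P eq h)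
  Any-resp-agree (_ ∷ eqs) (there i) = there (Any-resp-agree eqs i)

  infix 3 _⊨_⊢_
  _⊨_⊢_ : Assignment → List (PFm At) → List (PFm At) → Set
  a ⊨ Γ ⊢ Δ = a , v ⊨ₛ Γ ⊢ Δ

  left-rule : ∀ {a Γ Δ P Q} → (Holds a Q → Holds a P) → a ⊨ P ∷ Γ ⊢ Δ → a ⊨ Q ∷ Γ ⊢ Δ
  left-rule Q⇒P premise (hQ ∷ hΓ) = premise (Q⇒P hQ ∷ hΓ)

  right-rule : ∀ {a Γ Δ P Q} → (Holds a P → Holds a Q) → a ⊨ Γ ⊢ P ∷ Δ → a ⊨ Γ ⊢ Q ∷ Δ
  right-rule P⇒Q premise hΓ with premise hΓ
  ... | here hP  = here (P⇒Q hP)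
  ... | there hΔ = there hΔ

  contraction-right : ∀ {a Γ Δ P} → a ⊨ Γ ⊢ P ∷ P ∷ Δ → a ⊨ Γ ⊢ P ∷ Δ
  contraction-right premise hΓ with premise hΓ
  ... | here hP = here hP
  ... | there hPΔ = hPΔ

  cut-true : ∀ {a} Γ {Δ Γ′ Δ′ P} → a ⊨ Γ ⊢ P ∷ Δ → a ⊨ P ∷ Γ′ ⊢ Δ′ → a ⊨ Γ ++ Γ′ ⊢ Δ ++ Δ′
  cut-true Γ {Δ} premise₁ premise₂ hyps with All.++⁻ Γ hyps
  ... | hΓ , hΓ′ with premise₁ hΓ
  ... | here hP  = Any.++⁺ʳ Δ (premise₂ (hP ∷ hΓ′))
  ... | there hΔ = Any.++⁺ˡ hΔ

  -- ⇒L is a cut of the first premise against the second, read through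
  -- modus ponens
  ⇒L-true : ∀ {a} Γ {Δ Γ′ Δ′ A B s} → a ⊨ Γ ⊢ (A ^ s) ∷ Δ → a ⊨ (B ^ s) ∷ Γ′ ⊢ Δ′ →
            a ⊨ ((A ⇒ B) ^ s) ∷ Γ ++ Γ′ ⊢ Δ ++ Δ′
  ⇒L-true Γ premise₁ premise₂ (hA⇒B ∷ hyps) =
    cut-true Γ premise₁ (left-rule hA⇒B premise₂) hyps

  ∧R-true : ∀ {a Γ Δ A B s} → a ⊨ Γ ⊢ (A ^ s) ∷ Δ → a ⊨ Γ ⊢ (B ^ s) ∷ Δ →
            a ⊨ Γ ⊢ ((A ∧′ B) ^ s) ∷ Δ
  ∧R-true premise₁ premise₂ hΓ with premise₁ hΓ | premise₂ hΓ
  ... | here hA  | here hB  = here (hA , hB)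
  ... | here _   | there hΔ = there hΔ
  ... | there hΔ | _        = there hΔ

  ∨L-true : ∀ {a Γ Δ A B s} → a ⊨ (A ^ s) ∷ Γ ⊢ Δ → a ⊨ (B ^ s) ∷ Γ ⊢ Δ →
            a ⊨ ((A ∨′ B) ^ s) ∷ Γ ⊢ Δ
  ∨L-true premise₁ premise₂ (inj₁ hA ∷ hΓ) = premise₁ (hA ∷ hΓ)
  ∨L-true premise₁ premise₂ (inj₂ hB ∷ hΓ) = premise₂ (hB ∷ hΓ)

  ¬L-true : ∀ {a Γ Δ A s} → a ⊨ Γ ⊢ (A ^ s) ∷ Δ → a ⊨ ((¬′ A) ^ s) ∷ Γ ⊢ Δ
  ¬L-true premise (¬hA ∷ hΓ) with premise hΓ
  ... | here hA  = ⊥-elim (¬hA hA)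
  ... | there hΔ = hΔ

  -- ¬R and ⇒R case on whether A holds, which needs excluded middle
  ¬R-true : ExcludedMiddle 0ℓ → ∀ {a Γ Δ A s} → a ⊨ (A ^ s) ∷ Γ ⊢ Δ →
            a ⊨ Γ ⊢ ((¬′ A) ^ s) ∷ Δ
  ¬R-true lem {a} {A = A} {s} premise hΓ with lem {Holds a (A ^ s)}
  ... | yes hA = there (premise (hA ∷ hΓ))
  ... | no ¬hA = here ¬hA

  ⇒R-true : ExcludedMiddle 0ℓ → ∀ {a Γ Δ A B s} → a ⊨ (A ^ s) ∷ Γ ⊢ (B ^ s) ∷ Δ →
            a ⊨ Γ ⊢ ((A ⇒ B) ^ s) ∷ Δ
  ⇒R-true lem {a} {A = A} {s = s} premise hΓ with lem {Holds a (A ^ s)}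
  ... | yes hA = right-rule (λ hB _ → hB) (λ hΓ′ → premise (hA ∷ hΓ′)) hΓ
  ... | no ¬hA = here (λ hA → ⊥-elim (¬hA hA))

  -- □R: if Δ fails, every time k ≥ a(s) is the value of s ⊕ x in a model
  -- differing from a only at the fresh token x, where the premise gives A
  □R-true : ExcludedMiddle 0ℓ → ∀ {a Γ Δ A s} x → x ∉ₚ s → x ∉ₗ Γ → x ∉ₗ Δ →
            (∀ b → b ⊨ Γ ⊢ (A ^ (s ⊕ₜ x)) ∷ Δ) → a ⊨ Γ ⊢ ((□ A) ^ s) ∷ Δ
  □R-true lem {a} {Δ = Δ} {A} {s} x x∉s x∉Γ x∉Δ premise hΓ with lem {Any (Holds a) Δ}
  ... | yes hΔ = there hΔ
  ... | no ¬hΔ = here always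
    where
    always : ∀ k → evalPos a s ≤ k → v ⊨[ k ] A
    always k s≤k with premise (a [ x ≔ k ∸ evalPos a s ])
                              (All-resp-agree (agree-≔-fresh a x _ x∉Γ) hΓ)
    ... | here hA  = subst (λ m → v ⊨[ m ] A) (reach a s x k x∉s s≤k) hA
    ... | there hΔ = ⊥-elim (¬hΔ (Any-resp-agree (agree-sym (agree-≔-fresh a x _ x∉Δ)) hΔ))

  -- ◇L: move to the model where s ⊕ x denotes the witnessing time
  ◇L-true : ∀ {a Γ Δ A s} x → x ∉ₚ s → x ∉ₗ Γ → x ∉ₗ Δ →
            (∀ b → b ⊨ (A ^ (s ⊕ₜ x)) ∷ Γ ⊢ Δ) → a ⊨ ((◇ A) ^ s) ∷ Γ ⊢ Δ
  ◇L-true {a} {A = A} {s} x x∉s x∉Γ x∉Δ premise ((k , s≤k , hA) ∷ hΓ) =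
    Any-resp-agree (agree-sym (agree-≔-fresh a x _ x∉Δ))
      (premise (a [ x ≔ k ∸ evalPos a s ])
        (subst (λ m → v ⊨[ m ] A) (sym (reach a s x k x∉s s≤k)) hA
         ∷ All-resp-agree (agree-≔-fresh a x _ x∉Γ) hΓ))

  □L-true : ∀ {a Γ Δ A s} t → a ⊨ (A ^ (s ⊕ t)) ∷ Γ ⊢ Δ → a ⊨ ((□ A) ^ s) ∷ Γ ⊢ Δ
  □L-true {a} {s = s} t = left-rule (λ always → always _ (evalPos-⊕-≥ a s t))

  ◇R-true : ∀ {a Γ Δ A s} t → a ⊨ Γ ⊢ (A ^ (s ⊕ t)) ∷ Δ → a ⊨ Γ ⊢ ((◇ A) ^ s) ∷ Δ
  ◇R-true {a} {s = s} t = right-rule (λ hA → _ , evalPos-⊕-≥ a s t , hA)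

  ○L-true : ∀ {a Γ Δ A s} → a ⊨ (A ^ (s ⊕ₙ 1)) ∷ Γ ⊢ Δ → a ⊨ ((○ A) ^ s) ∷ Γ ⊢ Δ
  ○L-true {a} {A = A} {s} = left-rule (subst (λ m → v ⊨[ m ] A) (sym (evalPos-⊕-1 a s)))

  ○R-true : ∀ {a Γ Δ A s} → a ⊨ Γ ⊢ (A ^ (s ⊕ₙ 1)) ∷ Δ → a ⊨ Γ ⊢ ((○ A) ^ s) ∷ Δ
  ○R-true {a} {A = A} {s} = right-rule (subst (λ m → v ⊨[ m ] A) (evalPos-⊕-1 a s))

  induction-from : ∀ {A m} → v ⊨[ m ] A →
                   (∀ k → m ≤ k → v ⊨[ k ] A → v ⊨[ suc k ] A) →
                   ∀ {k} → m ≤′ k → v ⊨[ k ] A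
  induction-from base step ≤′-refl            = base
  induction-from {A} base step (≤′-step m≤′k) =
    step _ (≤′⇒≤ m≤′k) (induction-from {A} base step m≤′k)

  induction-axiom-true : ∀ {a A s} → a ⊨ [] ⊢ (((A ∧′ □ (A ⇒ ○ A)) ⇒ □ A) ^ s) ∷ []
  induction-axiom-true {A = A} [] =
    here λ (base , step) k s≤k → induction-from {A} base step (≤⇒≤′ s≤k)

  sound : ExcludedMiddle 0ℓ → ∀ {Γ Δ} → Γ ⊢ Δ → ∀ a → a ⊨ Γ ⊢ Δ
  sound lem ax                   a (h ∷ []) = here h
  sound lem (cut {Γ = Γ} d e)    a = cut-true Γ (sound lem d a) (sound lem e a)
  sound lem (wL d)               a (_ ∷ hΓ) = sound lem d a hΓ
  sound lem (wR d)               a hΓ = there (sound lem d a hΓ)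
  sound lem (cL d)               a (h ∷ hΓ) = sound lem d a (h ∷ h ∷ hΓ)
  sound lem (cR d)               a = contraction-right (sound lem d a)
  sound lem (eL Γ₁ d)            a hΓ =
    sound lem d a (All-resp-↭ (++⁺ˡ Γ₁ (↭-swap _ _ ↭-refl)) hΓ)
  sound lem (eR Δ₁ d)            a hΓ =
    Any-resp-↭ (++⁺ˡ Δ₁ (↭-swap _ _ ↭-refl)) (sound lem d a hΓ)
  sound lem (¬L d)               a = ¬L-true (sound lem d a)
  sound lem (¬R d)               a = ¬R-true lem (sound lem d a)
  sound lem (∧L₁ d)              a = left-rule (λ (hA , _) → hA) (sound lem d a)
  sound lem (∧L₂ d)              a = left-rule (λ (_ , hB) → hB) (sound lem d a)
  sound lem (∧R d e)             a = ∧R-true (sound lem d a) (sound lem e a)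
  sound lem (∨L d e)             a = ∨L-true (sound lem d a) (sound lem e a)
  sound lem (∨R₁ d)              a = right-rule inj₁ (sound lem d a)
  sound lem (∨R₂ d)              a = right-rule inj₂ (sound lem d a)
  sound lem (⇒L {Γ = Γ} d e)     a = ⇒L-true Γ (sound lem d a) (sound lem e a)
  sound lem (⇒R d)               a = ⇒R-true lem (sound lem d a)
  sound lem (□L t d)             a = □L-true t (sound lem d a)
  sound lem (□R x x∉s x∉Γ x∉Δ d) a = □R-true lem x x∉s x∉Γ x∉Δ (sound lem d)
  sound lem (◇L x x∉s x∉Γ x∉Δ d) a = ◇L-true x x∉s x∉Γ x∉Δ (sound lem d)
  sound lem (◇R t d)             a = ◇R-true t (sound lem d a)
  sound lem (○L d)               a = ○L-true (sound lem d a)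
  sound lem (○R d)               a = ○R-true (sound lem d a)
  sound lem ind                  a = induction-axiom-true

mainTheorem17 : ExcludedMiddle 0ℓ → {At : Set} → (Γ Δ : List (PFm At)) →
    Γ ⊢ Δ → Γ ⊨₂ Δ
mainTheorem17 lem Γ Δ derivation a v = Soundness.sound v lem derivation a
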